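{- For every integer $n\ge 3$, $\mu_{\rm o}(L(K_n))={\rm ex}(n;K_4^-)$.
   Context: $L(K_n)$ is the line graph of the complete graph $K_n$. For a connected graph $H$ and $X\subseteq V(H)$, two vertices are $X$-visible if there is a shortest path between them whose internal vertices are not in $X$; $X$ is an outer mutual-visibility set if every two vertices of $X$ are $X$-visible and every $x\in X$, $y\in V(H)\setminus X$ are $X$-visible, and $\mu_{\rm o}(H)$ is the maximum cardinality of such a set. $K_4^-$ is $K_4$ minus one edge, and ${\rm ex}(n;H')$ is the maximum number of edges of an $n$-vertex graph not containing $H'$ as a subgraph. -}

module Defs where

open import Data.Nat using (ℕ; zero; suc; _≤_; _<_)
open import Data.Fin using (Fin) renaming (_<_ to _<ᶠ_)
open import Data.Product using (Σ; ∃; _×_; _,_)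
open import Data.Sum using (_⊎_)
open import Data.Unit using (⊤)
open import Data.List using (List; length)
open import Data.List.Membership.Propositional using (_∈_; _∉_)
open import Data.List.Relation.Unary.Unique.Propositional using (Unique)
open import Relation.Binary.PropositionalEquality using (_≡_)
open import Relation.Nullary using (¬_)

record Graph : Set₁ where
  field
    V   : Set
    Adj : V → V → Set
open Graph public

module _ (G : Graph) where

  data Walk : V G → V G → ℕ → Set where
    nil  : ∀ {u} → Walk u u zero
    cons : ∀ {u w v k} → Adj G u w → Walk w v k → Walk u v (suc k)

  IsShortest : ∀ {u v k} → Walk u v k → Set
  IsShortest {u} {v} {k} _ = ∀ k′ → k′ < k → ¬ Walk u v k′

  -- all internal vertices of the walk avoid X
  -- (tailAvoids p : every vertex of p except its last one avoids X)
  tailAvoids : List (V G) → ∀ {w v k} → Walk w v k → Set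
  tailAvoids X nil = ⊤
  tailAvoids X (cons {u = w} _ p) = (w ∉ X) × tailAvoids X p

  internalAvoids : List (V G) → ∀ {u v k} → Walk u v k → Set
  internalAvoids X nil = ⊤
  internalAvoids X (cons _ p) = tailAvoids X p

  Visible : List (V G) → V G → V G → Set
  Visible X u v = Σ ℕ λ k → Σ (Walk u v k) λ p → IsShortest p × internalAvoids X p

  IsOuterMV : List (V G) → Set
  IsOuterMV X =
    Unique X ×
    (∀ x y → x ∈ X → y ∈ X → Visible X x y) ×
    (∀ x y → x ∈ X → y ∉ X → Visible X x y)

  IsMuO : ℕ → Set
  IsMuO m =
    (Σ (List (V G)) λ X → IsOuterMV X × length X ≡ m) ×
    (∀ X → IsOuterMV X → length X ≤ m)

-- 2-subsets of Fin n, written {i,j} with i < j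

Pair : ℕ → Set
Pair n = Σ (Fin n × Fin n) λ { (i , j) → i <ᶠ j }

-- L(K_n): vertices are the edges {i,j} of K_n; two are adjacent iff
-- they are distinct and share an endpoint
LK : ℕ → Graph
LK n = record
  { V   = Pair n
  ; Adj = λ { ((i , j) , _) ((k , l) , _) →
              ¬ (i ≡ k × j ≡ l) × (i ≡ k ⊎ i ≡ l ⊎ j ≡ k ⊎ j ≡ l) }
  }

-- Simple graphs on vertex set Fin n, given by a duplicate-free edge list

EAdj : ∀ {n} → List (Pair n) → Fin n → Fin n → Set
EAdj E u v = (Σ (u <ᶠ v) λ p → ((u , v) , p) ∈ E)
           ⊎ (Σ (v <ᶠ u) λ p → ((v , u) , p) ∈ E)

ContainsK4⁻ : ∀ {n} → List (Pair n) → Set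
ContainsK4⁻ {n} E = Σ (Fin n) λ a → Σ (Fin n) λ b → Σ (Fin n) λ c → Σ (Fin n) λ d →
  ¬ a ≡ b × ¬ a ≡ c × ¬ a ≡ d × ¬ b ≡ c × ¬ b ≡ d × ¬ c ≡ d ×
  EAdj E a b × EAdj E a c × EAdj E a d × EAdj E b c × EAdj E b d

IsExK4⁻ : ℕ → ℕ → Set
IsExK4⁻ n m =
  (Σ (List (Pair n)) λ E → Unique E × ¬ ContainsK4⁻ E × length E ≡ m) ×
  (∀ (E : List (Pair n)) → Unique E → ¬ ContainsK4⁻ E → length E ≤ m)

-- Let X be a set of edges of K_n, i.e. of vertices of L(K_n). Two edges x, y of K_n are at
-- distance 0, 1 or 2 in L(K_n), and if x = ab and y = cd are disjoint, the internal vertices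
-- of the shortest x–y paths are exactly the edges ac, ad, bc, bd. Hence X is an outer
-- mutual-visibility set iff no x ∈ X has all four of these edges in X for some disjoint y,
-- i.e. iff the graph ([n], X) contains no K_4^- (with the missing edge cd). So the outer
-- mutual-visibility sets of L(K_n) are exactly the K_4^--free edge sets, and the two maxima
-- coincide; both exist because the edge sets of K_n form a finite, decidable search space.
module Submission where

open import Defs
open import Data.Nat using (ℕ; zero; suc; _≤_; _<_; z≤n; s≤s)
open import Data.Nat.Properties using (≤-trans; ≤-pred; ≤∧≢⇒<)
open import Data.Product using (Σ; _×_; _,_; proj₁; proj₂)
open import Data.Product.Properties using (≡-dec)
open import Data.Sum using (_⊎_; inj₁; inj₂; [_,_]′)
open import Data.Unit using (tt)
open import Data.Empty using (⊥-elim)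
open import Data.Fin using (Fin) renaming (_<_ to _<ᶠ_)
open import Data.Fin.Properties using (_≟_; _<?_; <-cmp; <-irrelevant; <-asym; <-irrefl; any?)
open import Data.List using (List; []; _∷_; length; filter; map; cartesianProduct; allFin)
open import Data.List.Properties using (filter-notAll; length-map)
open import Data.List.Relation.Unary.Any using (here; there)
import Data.List.Relation.Unary.Any as Any
import Data.List.Relation.Unary.All as All
open import Data.List.Relation.Unary.AllPairs using ([]; _∷_)
open import Data.List.Relation.Unary.Unique.Propositional using (Unique)
open import Data.List.Relation.Unary.Unique.Propositional.Properties using () renaming (map⁺ to Unique-map⁺)
open import Data.List.Relation.Unary.Unique.DecPropositional using (unique?)
open import Data.List.Membership.Propositional using (_∈_; _∉_)
open import Data.List.Membership.Propositional.Properties using (∈-filter⁺; ∈-cartesianProduct⁺; ∈-allFin)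
import Data.List.Membership.DecPropositional as DecMembership
open import Relation.Binary using (DecidableEquality; tri<; tri≈; tri>)
open import Relation.Binary.PropositionalEquality using (_≡_; _≢_; refl; sym; cong; subst)
open import Relation.Nullary using (¬_; Dec; yes; no)
open import Relation.Nullary.Decidable using (_×-dec_; _⊎-dec_; map′; ¬?)
open import Relation.Unary using (Decidable)

-- Finite search

Searchable : Set → Set₁
Searchable A = ∀ {P : A → Set} → Decidable P → Dec (Σ A P)

unique⊆⇒length≤ : {A : Set} → DecidableEquality A → (xs ys : List A) →
                  Unique xs → (∀ {x} → x ∈ xs → x ∈ ys) → length xs ≤ length ys
unique⊆⇒length≤ _≟ᴬ_ []       ys _             _    = z≤n
unique⊆⇒length≤ _≟ᴬ_ (x ∷ xs) ys (x∉xs ∷ uxs) xs⊆ys =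
  ≤-trans (s≤s (unique⊆⇒length≤ _≟ᴬ_ xs (filter ≢x? ys) uxs xs⊆ys-x))
          (filter-notAll ≢x? ys (Any.map (λ x≡y x≢y → x≢y x≡y) (xs⊆ys (here refl))))
  where
    ≢x? = λ y → ¬? (x ≟ᴬ y)
    xs⊆ys-x : ∀ {y} → y ∈ xs → y ∈ filter ≢x? ys
    xs⊆ys-x y∈xs = ∈-filter⁺ ≢x? (xs⊆ys (there y∈xs)) (All.lookup x∉xs y∈xs)

bounded-max : {P : ℕ → Set} → Decidable P → P 0 → (b : ℕ) → (∀ k → P k → k ≤ b) →
              Σ ℕ λ m → P m × (∀ k → P k → k ≤ m)
bounded-max P? p₀ b ≤b with P? b
... | yes pb = b , pb , ≤b
bounded-max P? p₀ zero    ≤b | no ¬p₀ = ⊥-elim (¬p₀ p₀)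
bounded-max {P} P? p₀ (suc b) ≤b | no ¬pb = bounded-max P? p₀ b ≤b′
  where
    ≤b′ : ∀ k → P k → k ≤ b
    ≤b′ k pk = ≤-pred (≤∧≢⇒< (≤b k pk) λ { refl → ¬pb pk })

module _ {A : Set} (search : Searchable A) where

  ∃-of-length? : {R : List A → Set} → Decidable R → ∀ k →
                 Dec (Σ (List A) λ l → R l × length l ≡ k)
  ∃-of-length? R? zero with R? []
  ... | yes r = yes ([] , r , refl)
  ... | no ¬r = no λ { ([] , r , _) → ¬r r ; (_ ∷ _ , _ , ()) }
  ∃-of-length? {R} R? (suc k)
    with search (λ x → ∃-of-length? {λ l → R (x ∷ l)} (λ l → R? (x ∷ l)) k)
  ... | yes (x , l , r , refl) = yes (x ∷ l , r , refl)
  ... | no ¬∃ = no λ { (x ∷ l , r , refl) → ¬∃ (x , l , r , refl) }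

  longest : {R : List A → Set} → Decidable R → R [] → (b : ℕ) → (∀ l → R l → length l ≤ b) →
            Σ ℕ λ m → (Σ (List A) λ l → R l × length l ≡ m) × (∀ l → R l → length l ≤ m)
  longest {R} R? r₀ b ≤b with bounded-max (∃-of-length? R?) ([] , r₀ , refl) b ≤b′
    where
      ≤b′ : ∀ k → Σ (List A) (λ l → R l × length l ≡ k) → k ≤ b
      ≤b′ _ (l , r , refl) = ≤b l r
  ... | m , witness , ≤m = m , witness , λ l r → ≤m (length l) (l , r , refl)

-- Shortest paths of length at most two

module _ (G : Graph) {X : List (V G)} where

  walk₀⇒≡ : ∀ {u v} → Walk G u v 0 → u ≡ v
  walk₀⇒≡ nil = refl

  walk₁⇒adjacent : ∀ {u v} → Walk G u v 1 → Adj G u v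
  walk₁⇒adjacent (cons uv nil) = uv

  no-walk-below-2 : ∀ {u v} → u ≢ v → ¬ Adj G u v → ∀ k → k < 2 → ¬ Walk G u v k
  no-walk-below-2 u≢v _   zero          _                 p = u≢v (walk₀⇒≡ p)
  no-walk-below-2 _   ¬uv (suc zero)    _                 p = ¬uv (walk₁⇒adjacent p)
  no-walk-below-2 _   _   (suc (suc _)) (s≤s (s≤s ())) _

  visible-refl : ∀ {u} → Visible G X u u
  visible-refl = 0 , nil , (λ _ ()) , tt

  visible-adjacent : ∀ {u v} → u ≢ v → Adj G u v → Visible G X u v
  visible-adjacent u≢v uv = 1 , cons uv nil , shortest , tt
    where
      shortest : ∀ k → k < 1 → ¬ Walk G _ _ k
      shortest zero    _        p = u≢v (walk₀⇒≡ p)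
      shortest (suc _) (s≤s ()) _

  visible-via : ∀ {u v w} → u ≢ v → ¬ Adj G u v → Adj G u w → Adj G w v → w ∉ X →
                Visible G X u v
  visible-via u≢v ¬uv uw wv w∉X =
    2 , cons uw (cons wv nil) , no-walk-below-2 u≢v ¬uv , w∉X , tt

  visible⇒middle : ∀ {u v w} → u ≢ v → ¬ Adj G u v → Adj G u w → Adj G w v →
                   Visible G X u v → Σ (V G) λ w′ → Adj G u w′ × Adj G w′ v × w′ ∉ X
  visible⇒middle u≢v _   _  _  (0 , p , _)     = ⊥-elim (u≢v (walk₀⇒≡ p))
  visible⇒middle _   ¬uv _  _  (1 , p , _)     = ⊥-elim (¬uv (walk₁⇒adjacent p))
  visible⇒middle _   _   _  _  (2 , cons uw′ (cons w′v nil) , _ , w′∉X , _) = _ , uw′ , w′v , w′∉X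
  visible⇒middle _   _   uw wv (suc (suc (suc _)) , _ , shortest , _) =
    ⊥-elim (shortest 2 (s≤s (s≤s (s≤s z≤n))) (cons uw (cons wv nil)))

module _ {n : ℕ} where

  fst snd : Pair n → Fin n
  fst w = proj₁ (proj₁ w)
  snd w = proj₂ (proj₁ w)

  fst≢snd : (w : Pair n) → fst w ≢ snd w
  fst≢snd (_ , i<j) i≡j = <-irrefl i≡j i<j

  pair-ext : {x y : Pair n} → fst x ≡ fst y → snd x ≡ snd y → x ≡ y
  pair-ext {_ , p} {_ , q} refl refl = cong (_ ,_) (<-irrelevant p q)

  _≟ᵖ_ : DecidableEquality (Pair n)
  _≟ᵖ_ = ≡-dec (≡-dec _≟_ _≟_) (λ p q → yes (<-irrelevant p q))

  open DecMembership _≟ᵖ_ using (_∈?_)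

  pair-searchable : Searchable (Pair n)
  pair-searchable {P} P? = map′ (λ (i , j , i<j , pw) → ((i , j) , i<j) , pw)
                                (λ (((i , j) , i<j) , pw) → i , j , i<j , pw)
                                (any? λ i → any? λ j → ordered? i j)
    where
      ordered? : ∀ i j → Dec (Σ (i <ᶠ j) λ i<j → P ((i , j) , i<j))
      ordered? i j with i <? j
      ... | no i≮j = no λ (i<j , _) → i≮j i<j
      ... | yes i<j = map′ (i<j ,_) (λ (i<j′ , pw) → subst (λ q → P (_ , q)) (<-irrelevant i<j′ i<j) pw)
                           (P? ((i , j) , i<j))

  data Incident (a : Fin n) (w : Pair n) : Set where
    fst-end : fst w ≡ a → Incident a w
    snd-end : snd w ≡ a → Incident a w

  incident? : ∀ a w → Dec (Incident a w)
  incident? a w = map′ [ fst-end , snd-end ]′ (λ { (fst-end e) → inj₁ e ; (snd-end e) → inj₂ e })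
                       (fst w ≟ a ⊎-dec snd w ≟ a)

  data Joins (w : Pair n) (a b : Fin n) : Set where
    forwards  : fst w ≡ a → snd w ≡ b → Joins w a b
    backwards : fst w ≡ b → snd w ≡ a → Joins w a b

  Common : Pair n → Pair n → Set
  Common x y = Σ (Fin n) λ a → Incident a x × Incident a y

  joins-self : (w : Pair n) → Joins w (fst w) (snd w)
  joins-self _ = forwards refl refl

  joins-sym : ∀ {w a b} → Joins w a b → Joins w b a
  joins-sym (forwards e₁ e₂) = backwards e₁ e₂
  joins-sym (backwards e₁ e₂) = forwards e₁ e₂

  joins⇒incident : ∀ {w a b} → Joins w a b → Incident a w
  joins⇒incident (forwards refl _) = fst-end refl
  joins⇒incident (backwards _ refl) = snd-end refl

  incident-joins : ∀ {w a b c} → Joins w a b → Incident c w → c ≡ a ⊎ c ≡ b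
  incident-joins (forwards refl _) (fst-end refl) = inj₁ refl
  incident-joins (forwards _ refl) (snd-end refl) = inj₂ refl
  incident-joins (backwards refl _) (fst-end refl) = inj₂ refl
  incident-joins (backwards _ refl) (snd-end refl) = inj₁ refl

  incidents⇒joins : ∀ {w a b} → Incident a w → Incident b w → a ≢ b → Joins w a b
  incidents⇒joins (fst-end refl) (fst-end refl) a≢b = ⊥-elim (a≢b refl)
  incidents⇒joins (fst-end refl) (snd-end refl) _   = forwards refl refl
  incidents⇒joins (snd-end refl) (fst-end refl) _   = backwards refl refl
  incidents⇒joins (snd-end refl) (snd-end refl) a≢b = ⊥-elim (a≢b refl)

  joins-unique : ∀ {w w′ a b} → Joins w a b → Joins w′ a b → w ≡ w′
  joins-unique (forwards refl refl) (forwards refl refl) = pair-ext refl refl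
  joins-unique {_ , p} {_ , q} (forwards refl refl) (backwards refl refl) = ⊥-elim (<-asym p q)
  joins-unique {_ , p} {_ , q} (backwards refl refl) (forwards refl refl) = ⊥-elim (<-asym p q)
  joins-unique (backwards refl refl) (backwards refl refl) = pair-ext refl refl

  edge : ∀ {a b} → a ≢ b → Σ (Pair n) λ w → Joins w a b
  edge {a} {b} a≢b with <-cmp a b
  ... | tri< a<b _ _ = ((a , b) , a<b) , forwards refl refl
  ... | tri≈ _ a≡b _ = ⊥-elim (a≢b a≡b)
  ... | tri> _ _ b<a = ((b , a) , b<a) , backwards refl refl

  eadj⇒joins∈ : ∀ {E a b} → EAdj E a b → Σ (Pair n) λ w → Joins w a b × w ∈ E
  eadj⇒joins∈ (inj₁ (a<b , w∈E)) = (_ , a<b) , forwards refl refl , w∈E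
  eadj⇒joins∈ (inj₂ (b<a , w∈E)) = (_ , b<a) , backwards refl refl , w∈E

  joins∈⇒eadj : ∀ {E w a b} → Joins w a b → w ∈ E → EAdj E a b
  joins∈⇒eadj {w = _ , p} (forwards refl refl) w∈E = inj₁ (p , w∈E)
  joins∈⇒eadj {w = _ , p} (backwards refl refl) w∈E = inj₂ (p , w∈E)

  eadj-joins⇒∈ : ∀ {E w a b} → EAdj E a b → Joins w a b → w ∈ E
  eadj-joins⇒∈ {E} ab∈E jw with eadj⇒joins∈ ab∈E
  ... | w′ , jw′ , w′∈E = subst (_∈ E) (joins-unique jw′ jw) w′∈E

  -- Existence of ex(n; K_4^-)

  eadj? : ∀ E a b → Dec (EAdj {n} E a b)
  eadj? E a b with a ≟ b
  ... | yes refl = no λ { (inj₁ (a<a , _)) → <-irrefl refl a<a ; (inj₂ (a<a , _)) → <-irrefl refl a<a }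
  ... | no a≢b with edge a≢b
  ... | w , jw = map′ (joins∈⇒eadj jw) (λ ab∈E → eadj-joins⇒∈ ab∈E jw) (w ∈? E)

  containsK4⁻? : ∀ E → Dec (ContainsK4⁻ {n} E)
  containsK4⁻? E = any? λ a → any? λ b → any? λ c → any? λ d →
    ¬? (a ≟ b) ×-dec ¬? (a ≟ c) ×-dec ¬? (a ≟ d) ×-dec ¬? (b ≟ c) ×-dec
    ¬? (b ≟ d) ×-dec ¬? (c ≟ d) ×-dec eadj? E a b ×-dec eadj? E a c ×-dec
    eadj? E a d ×-dec eadj? E b c ×-dec eadj? E b d

  unique⇒length≤ : (E : List (Pair n)) → Unique E →
                   length E ≤ length (cartesianProduct (allFin n) (allFin n))
  unique⇒length≤ E uE = subst (_≤ _) (length-map proj₁ E)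
    (unique⊆⇒length≤ (≡-dec _≟_ _≟_) (map proj₁ E) _
      (Unique-map⁺ (λ ends≡ → pair-ext (cong proj₁ ends≡) (cong proj₂ ends≡)) uE)
      (λ {(i , j)} _ → ∈-cartesianProduct⁺ (∈-allFin i) (∈-allFin j)))

  ex-K4⁻ : Σ ℕ (IsExK4⁻ n)
  ex-K4⁻ with longest pair-searchable (λ E → unique? _≟ᵖ_ E ×-dec ¬? (containsK4⁻? E))
                      ([] , []-K4⁻-free) _ (λ E (uE , _) → unique⇒length≤ E uE)
    where
      []-K4⁻-free : ¬ ContainsK4⁻ {n} []
      []-K4⁻-free (_ , _ , _ , _ , _ , _ , _ , _ , _ , _ , inj₁ (_ , ()) , _)
      []-K4⁻-free (_ , _ , _ , _ , _ , _ , _ , _ , _ , _ , inj₂ (_ , ()) , _)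
  ... | m , (E , (uE , free) , len) , ≤m = m , (E , uE , free , len) , λ E uE free → ≤m E (uE , free)

  common? : ∀ x y → Dec (Common x y)
  common? x y = any? λ a → incident? a x ×-dec incident? a y

  common-sym : ∀ {x y} → Common x y → Common y x
  common-sym (a , ax , ay) = a , ay , ax

  adjacent⇒common : ∀ {x y} → Adj (LK n) x y → Common x y
  adjacent⇒common {x} (_ , inj₁ e)                 = fst x , fst-end refl , fst-end (sym e)
  adjacent⇒common {x} (_ , inj₂ (inj₁ e))          = fst x , fst-end refl , snd-end (sym e)
  adjacent⇒common {x} (_ , inj₂ (inj₂ (inj₁ e)))   = snd x , snd-end refl , fst-end (sym e)
  adjacent⇒common {x} (_ , inj₂ (inj₂ (inj₂ e)))   = snd x , snd-end refl , snd-end (sym e)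

  common⇒adjacent : ∀ {x y} → x ≢ y → Common x y → Adj (LK n) x y
  common⇒adjacent x≢y (_ , ax , ay) = (λ (e₁ , e₂) → x≢y (pair-ext e₁ e₂)) , share ax ay
    where
      share : ∀ {a x y} → Incident a x → Incident a y →
              fst x ≡ fst y ⊎ fst x ≡ snd y ⊎ snd x ≡ fst y ⊎ snd x ≡ snd y
      share (fst-end refl) (fst-end refl) = inj₁ refl
      share (fst-end refl) (snd-end refl) = inj₂ (inj₁ refl)
      share (snd-end refl) (fst-end refl) = inj₂ (inj₂ (inj₁ refl))
      share (snd-end refl) (snd-end refl) = inj₂ (inj₂ (inj₂ refl))

  adjacent-sym : ∀ {x y} → Adj (LK n) x y → Adj (LK n) y x
  adjacent-sym {x} {y} xy =
    common⇒adjacent (λ { refl → proj₁ xy (refl , refl) }) (common-sym (adjacent⇒common {x} {y} xy))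

  joins-adjacent : ∀ {x w a c} → Joins w a c → Incident a x → ¬ Incident c x → Adj (LK n) x w
  joins-adjacent jw ax ¬cx =
    common⇒adjacent (λ { refl → ¬cx (joins⇒incident (joins-sym jw)) }) (_ , ax , joins⇒incident jw)

  module _ {x y : Pair n} (disjoint : ¬ Common x y) where

    disjoint⇒≢ : x ≢ y
    disjoint⇒≢ refl = disjoint (fst x , fst-end refl , fst-end refl)

    disjoint⇒¬adjacent : ¬ Adj (LK n) x y
    disjoint⇒¬adjacent xy = disjoint (adjacent⇒common xy)

    disjoint⇒ends≢ : ∀ {a c} → Incident a x → Incident c y → a ≢ c
    disjoint⇒ends≢ ax cy refl = disjoint (_ , ax , cy)

    middle-adjacent : ∀ {w a c} → Incident a x → Incident c y → Joins w a c →
                      Adj (LK n) x w × Adj (LK n) w y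
    middle-adjacent {w} ax cy jw =
      joins-adjacent jw ax (λ cx → disjoint (_ , cx , cy)) ,
      adjacent-sym {y} {w} (joins-adjacent (joins-sym jw) cy (λ ay → disjoint (_ , ax , ay)))

    middle-edge-or-visible : ∀ {X a c} → Incident a x → Incident c y →
                             EAdj X a c ⊎ Visible (LK n) X x y
    middle-edge-or-visible {X} ax cy with edge (disjoint⇒ends≢ ax cy)
    ... | w , jw with w ∈? X
    ... | yes w∈X = inj₁ (joins∈⇒eadj jw w∈X)
    ... | no w∉X  = let (xw , wy) = middle-adjacent ax cy jw
                    in inj₂ (visible-via (LK n) disjoint⇒≢ disjoint⇒¬adjacent xw wy w∉X)

  K4⁻-free⇒visible-disjoint : ∀ {X x y} → ¬ ContainsK4⁻ X → x ∈ X → ¬ Common x y →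
                              Visible (LK n) X x y
  K4⁻-free⇒visible-disjoint {X} {x} {y} free x∈X disjoint
    with middle-edge-or-visible disjoint {X} (fst-end refl) (fst-end refl)
       | middle-edge-or-visible disjoint {X} (fst-end refl) (snd-end refl)
       | middle-edge-or-visible disjoint {X} (snd-end refl) (fst-end refl)
       | middle-edge-or-visible disjoint {X} (snd-end refl) (snd-end refl)
  ... | inj₂ visible | _ | _ | _ = visible
  ... | inj₁ _ | inj₂ visible | _ | _ = visible
  ... | inj₁ _ | inj₁ _ | inj₂ visible | _ = visible
  ... | inj₁ _ | inj₁ _ | inj₁ _ | inj₂ visible = visible
  ... | inj₁ ac | inj₁ ad | inj₁ bc | inj₁ bd = ⊥-elim (free
    (fst x , snd x , fst y , snd y ,
     fst≢snd x , ends≢ (fst-end refl) (fst-end refl) , ends≢ (fst-end refl) (snd-end refl) ,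
     ends≢ (snd-end refl) (fst-end refl) , ends≢ (snd-end refl) (snd-end refl) , fst≢snd y ,
     joins∈⇒eadj (joins-self x) x∈X , ac , ad , bc , bd))
    where ends≢ = disjoint⇒ends≢ disjoint

  K4⁻-free⇒visible : ∀ {X x} → ¬ ContainsK4⁻ X → x ∈ X → ∀ y → Visible (LK n) X x y
  K4⁻-free⇒visible {x = x} free x∈X y with x ≟ᵖ y
  ... | yes refl = visible-refl (LK n)
  ... | no x≢y with common? x y
  ... | yes common = visible-adjacent (LK n) x≢y (common⇒adjacent x≢y common)
  ... | no disjoint = K4⁻-free⇒visible-disjoint free x∈X disjoint

  K4⁻-free⇒outerMV : ∀ {X} → Unique X → ¬ ContainsK4⁻ X → IsOuterMV (LK n) X
  K4⁻-free⇒outerMV uX free =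
    uX , (λ _ y x∈X _ → K4⁻-free⇒visible free x∈X y) , (λ _ y x∈X _ → K4⁻-free⇒visible free x∈X y)

  joins-disjoint : ∀ {x y a b c d} → a ≢ c → a ≢ d → b ≢ c → b ≢ d →
                   Joins x a b → Joins y c d → ¬ Common x y
  joins-disjoint a≢c a≢d b≢c b≢d jx jy (e , ex , ey)
    with incident-joins jx ex | incident-joins jy ey
  ... | inj₁ refl | inj₁ refl = a≢c refl
  ... | inj₁ refl | inj₂ refl = a≢d refl
  ... | inj₂ refl | inj₁ refl = b≢c refl
  ... | inj₂ refl | inj₂ refl = b≢d refl

  K4⁻-blocks : ∀ {X x y a b c d} → a ≢ c → a ≢ d → b ≢ c → b ≢ d →
               EAdj X a c → EAdj X a d → EAdj X b c → EAdj X b d →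
               Joins x a b → Joins y c d → ¬ Visible (LK n) X x y
  K4⁻-blocks {X} {x} {y} {a} {b} {c} {d} a≢c a≢d b≢c b≢d ac ad bc bd jx jy visible =
    let disjoint        = joins-disjoint a≢c a≢d b≢c b≢d jx jy
        (v , jv)        = edge a≢c
        (xv , vy)       = middle-adjacent disjoint (joins⇒incident jx) (joins⇒incident jy) jv
        (w , xw , wy , w∉X) = visible⇒middle (LK n) {w = v} (disjoint⇒≢ disjoint)
                                             (disjoint⇒¬adjacent disjoint) xv vy visible
        (α , αx , αw)   = adjacent⇒common {x} {w} xw
        (γ , γw , γy)   = adjacent⇒common {w} {y} wy
    in w∉X (eadj-joins⇒∈ (cross (incident-joins jx αx) (incident-joins jy γy))
                         (incidents⇒joins αw γw (disjoint⇒ends≢ disjoint αx γy)))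
    where
      cross : ∀ {α γ} → α ≡ a ⊎ α ≡ b → γ ≡ c ⊎ γ ≡ d → EAdj X α γ
      cross (inj₁ refl) (inj₁ refl) = ac
      cross (inj₁ refl) (inj₂ refl) = ad
      cross (inj₂ refl) (inj₁ refl) = bc
      cross (inj₂ refl) (inj₂ refl) = bd

  outerMV⇒K4⁻-free : ∀ {X} → IsOuterMV (LK n) X → ¬ ContainsK4⁻ X
  outerMV⇒K4⁻-free {X} (_ , visible-in , visible-out)
                       (_ , _ , _ , _ , _ , a≢c , a≢d , b≢c , b≢d , c≢d , ab , ac , ad , bc , bd) =
    let (x , jx , x∈X) = eadj⇒joins∈ ab
        (y , jy)       = edge c≢d
    in K4⁻-blocks a≢c a≢d b≢c b≢d ac ad bc bd jx jy (visible x∈X y)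
    where
      visible : ∀ {x} → x ∈ X → ∀ y → Visible (LK n) X x y
      visible x∈X y with y ∈? X
      ... | yes y∈X = visible-in _ y x∈X y∈X
      ... | no y∉X  = visible-out _ y x∈X y∉X

  ex-K4⁻⇒μₒ : ∀ {m} → IsExK4⁻ n m → IsMuO (LK n) m
  ex-K4⁻⇒μₒ ((E , uE , free , len) , ≤m) =
    (E , K4⁻-free⇒outerMV uE free , len) , λ X mv → ≤m X (proj₁ mv) (outerMV⇒K4⁻-free mv)

theorem3p9 : (n : ℕ) → 3 ≤ n → Σ ℕ λ m → IsMuO (LK n) m × IsExK4⁻ n m
theorem3p9 n _ = let (m , ex) = ex-K4⁻ {n} in m , ex-K4⁻⇒μₒ ex , ex
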